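{- Let $\mathcal{F}\subset\mathcal{P}([n])$ be an increasing, $n$-stable family. Let $A,B\in\mathcal{I}_n(\mathcal{F})$ with $A\ne B$, and let $\mathcal{F}_1=(\mathcal{F}\setminus\{A\})\cup\{B\setminus\{n\}\}$ and $\mathcal{F}_2=(\mathcal{F}\setminus\{B\})\cup\{A\setminus\{n\}\}$. Then either $I[\mathcal{F}_1]<I[\mathcal{F}]$ or $I[\mathcal{F}_2]<I[\mathcal{F}]$.
   Context: $\mathcal{F}\subset\mathcal{P}([n])$ is increasing if $A\in\mathcal{F}$, $A\subset B$ imply $B\in\mathcal{F}$. For $i\ne j$, the shift $\mathcal{S}_{i,j}$ replaces each $A\in\mathcal{F}$ with $i\in A$, $j\notin A$ and $(A\setminus\{i\})\cup\{j\}\notin\mathcal{F}$ by $(A\setminus\{i\})\cup\{j\}$. $\mathcal{F}$ is $n$-stable if $\mathcal{S}_{n,i}(\mathcal{F})=\mathcal{F}$ for each $i\in[n-1]$ and $A\cup\{n\}\in\mathcal{F}$ whenever $A\in\mathcal{F}$. $\mathcal{I}_n(\mathcal{F})=\{A\in\mathcal{F}:A\Delta\{n\}\notin\mathcal{F}\}$. $I[\mathcal{F}]=\sum_i\mathrm{Inf}_i[\mathcal{F}]$, where $\mathrm{Inf}_i[\mathcal{F}]$ is the probability, for uniform $A\in\mathcal{P}([n])$, that exactly one of $A$, $A\Delta\{i\}$ lies in $\mathcal{F}$. -}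

module Defs where

open import Data.Bool using (Bool; true; false; not; _∧_; _∨_; _xor_; if_then_else_)
open import Data.Nat as ℕ using (ℕ; zero; suc; _^_)
open import Data.Nat.Properties using (m^n≢0)
open import Data.Fin using (Fin; fromℕ)
open import Data.Fin.Subset using (Subset; _⊆_; outside; inside)
open import Data.Vec.Properties using (≡-dec)
import Data.Bool as B
open import Data.Product using (_×_)
open import Relation.Nullary using (¬_)
open import Relation.Binary using (DecidableEquality)

_≟S_ : ∀ {n} → DecidableEquality (Subset n)
_≟S_ = ≡-dec B._≟_
open import Data.Vec using (Vec; []; _∷_; lookup; _[_]≔_)
open import Data.List using (List; [_]; _++_; map; foldr; filter; length)
open import Data.List using () renaming (allFin to allFinL)
open import Data.Integer using (+_)
open import Data.Rational using (ℚ; _/_; 0ℚ) renaming (_+_ to _+ℚ_)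
open import Relation.Nullary.Decidable using (⌊_⌋)
open import Relation.Binary.PropositionalEquality using (_≡_)

-- A family 𝓕 ⊆ 𝓟([n]) is given by its (Boolean) characteristic function;
-- subsets of [n] are Data.Fin.Subset n (ground set Fin n, i.e. {1..n} shifted).
Family : ℕ → Set
Family n = Subset n → Bool

_∈F_ : ∀ {n} → Subset n → Family n → Set
A ∈F F = F A ≡ true

allSubsets : ∀ n → List (Subset n)
allSubsets zero = [ [] ]
allSubsets (suc n) = map (inside ∷_) (allSubsets n) ++ map (outside ∷_) (allSubsets n)

flipAt : ∀ {n} → Fin n → Subset n → Subset n
flipAt i A = A [ i ]≔ not (lookup A i)

Increasing : ∀ {n} → Family n → Set
Increasing F = ∀ A B → A ⊆ B → A ∈F F → B ∈F F

move : ∀ {n} → Fin n → Fin n → Subset n → Subset n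
move i j A = (A [ i ]≔ outside) [ j ]≔ inside

-- the shift S_{i,j}: A ∈ 𝓕 with i ∈ A, j ∉ A, (A\{i})∪{j} ∉ 𝓕 is replaced
-- by (A\{i})∪{j}.
isMoved : ∀ {n} → Fin n → Fin n → Family n → Subset n → Bool
isMoved i j F A = lookup A i ∧ not (lookup A j) ∧ not (F (move i j A))

-- C ∈ S_{i,j}(𝓕) iff (C ∈ 𝓕 and C is not moved) or C is the image of some
-- moved D ∈ 𝓕, i.e. (C = (D\{i})∪{j}); we search over all D explicitly.
shift : ∀ {n} → Fin n → Fin n → Family n → Family n
shift {n} i j F C =
  (F C ∧ not (isMoved i j F C)) ∨
  foldr (λ D b → (F D ∧ isMoved i j F D ∧ ⌊ move i j D ≟S C ⌋) ∨ b) false (allSubsets n)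

-- the distinguished element n of [n] (here: the last element of Fin (suc m))
lastE : ∀ m → Fin (suc m)
lastE m = fromℕ m

Stable : ∀ m → Family (suc m) → Set
Stable m F =
  (∀ (i : Fin (suc m)) → ¬ (i ≡ lastE m) → ∀ C → shift (lastE m) i F C ≡ F C)
  × (∀ A → A ∈F F → (A [ lastE m ]≔ inside) ∈F F)

_∈I_ : ∀ {m} → Subset (suc m) → Family (suc m) → Set
_∈I_ {m} A F = A ∈F F × F (flipAt (lastE m) A) ≡ false

Inf : ∀ {n} → Fin n → Family n → ℚ
Inf {n} i F = _/_ (+ length (filter (λ A → F A B.≟ not (F (flipAt i A))) (allSubsets n)))
                  (2 ^ n) {{m^n≢0 2 n}}

TotalInf : ∀ {n} → Family n → ℚ
TotalInf {n} F = foldr (λ i q → Inf i F +ℚ q) 0ℚ (allFinL n)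

replace : ∀ {n} → Family n → Subset n → Subset n → Family n
replace F A C D = (F D ∧ not ⌊ D ≟S A ⌋) ∨ ⌊ D ≟S C ⌋

dropLast : ∀ {m} → Subset (suc m) → Subset (suc m)
dropLast {m} B = B [ lastE m ]≔ outside

module Submission where

-- For A ∈ 𝓘_n(𝓕), monotonicity and n-stability force A to be critical: A ∪ {i} ∈ 𝓕 for
-- every i ∉ A and A ∖ {i} ∉ 𝓕 for every i ∈ A (for i ≠ n, shifting A ∖ {i} along S_{n,i}
-- would otherwise put A ∖ {n} into 𝓕). Dually P = B ∖ {n} is critical outside 𝓕. In each
-- direction i, replacing A by P changes only the two edges {A, A Δ {i}} and {P, P Δ {i}},
-- so the number of i-pivotal sets changes by 4 ([i ∈ P] − [i ∈ A]) and, summing over i,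
-- 2^n (I[𝓕₁] − I[𝓕]) = 4 (|B| − 1 − |A|). Hence 𝓕₁ has smaller total influence when
-- |B| ≤ |A|, and symmetrically 𝓕₂ does when |A| ≤ |B|.

open import Defs
open import Data.Bool as Bool using (Bool; true; false; not; _∧_; _∨_; _xor_; if_then_else_)
open import Data.Bool.Properties
  using (∧-zeroʳ; ∧-identityʳ; ∨-zeroʳ; ∨-identityʳ; not-involutive; xor-comm; not-¬; ¬-not)
open import Data.Empty using (⊥-elim)
open import Data.Fin as Fin using (Fin; punchIn) renaming (_≟_ to _≟ᶠ_)
open import Data.Fin.Properties using (punchInᵢ≢i)
open import Data.Fin.Subset using (Subset; _⊆_; inside; outside)
import Data.Integer.Base as ℤ
import Data.Integer.Properties as ℤ
open import Data.List using (List; []; _∷_; _++_; map; filter; length; foldr; tabulate)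
open import Data.List.Properties using (map-++; map-∘; map-cong)
open import Data.Nat.Base as ℕ using (ℕ; zero; suc; _+_; _*_; _^_; _≤_; pred; NonZero; ≢-nonZero⁻¹)
import Data.Nat.Properties as ℕ
open import Data.Nat.ListAction using (sum)
open import Data.Nat.ListAction.Properties using (sum-++)
open import Data.Product using (_,_; proj₁)
open import Data.Rational using (_<_; _/_; 0ℚ; toℚᵘ) renaming (_+_ to _+ℚ_)
import Data.Rational.Properties as ℚ
open import Data.Rational.Unnormalised using (mkℚᵘ; _≃_; *≡*; *<*)
  renaming (_+_ to _+ᵘ_; _<_ to _<ᵘ_)
import Data.Rational.Unnormalised.Properties as ℚᵘ
open import Data.Sum as Sum using (_⊎_)
open import Data.Vec using (_∷_; []; lookup; _[_]≔_)
open import Data.Vec.Properties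
  using ( ∷-injectiveˡ; ∷-injectiveʳ; lookup∘update; lookup∘update′; []≔-idempotent; []≔-commutes
        ; []≔-lookup; []≔-updates; []≔-minimal; []=⇒lookup; lookup⇒[]=)
open import Function using (_∘_)
open import Relation.Nullary using (¬_; yes; no; does; contradiction)
open import Relation.Nullary.Decidable using (⌊_⌋)
open import Relation.Unary using (Pred; Decidable)
open import Relation.Binary.PropositionalEquality
  using (_≡_; _≢_; _≗_; refl; sym; trans; cong; cong₂; subst; subst₂; module ≡-Reasoning)
open import Algebra.Properties.CommutativeSemigroup ℕ.+-commutativeSemigroup
  using (xy∙z≈xz∙y; xy∙z≈zy∙x; x∙yz≈xz∙y)
open import Algebra.Properties.Semiring.Sum ℕ.+-*-semiring
  using (sum-syntax; sum-remove; sum-cong-≗; ∑-distrib-+; *-distribˡ-sum)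

𝟙 : Bool → ℕ
𝟙 true  = 1
𝟙 false = 0

flipAt-≡ : ∀ {n} {X : Subset n} {i b} → lookup X i ≡ b → flipAt i X ≡ X [ i ]≔ not b
flipAt-≡ refl = refl

flipAt-involutive : ∀ {n} (i : Fin n) (X : Subset n) → flipAt i (flipAt i X) ≡ X
flipAt-involutive i X = begin
  (X [ i ]≔ not (lookup X i)) [ i ]≔ not (lookup (X [ i ]≔ not (lookup X i)) i)
    ≡⟨ []≔-idempotent X i ⟩
  X [ i ]≔ not (lookup (X [ i ]≔ not (lookup X i)) i)
    ≡⟨ cong (λ b → X [ i ]≔ not b) (lookup∘update i X _) ⟩
  X [ i ]≔ not (not (lookup X i))
    ≡⟨ cong (X [ i ]≔_) (not-involutive _) ⟩
  X [ i ]≔ lookup X i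
    ≡⟨ []≔-lookup X i ⟩
  X ∎
  where open ≡-Reasoning

flipAt-≢ : ∀ {n} (i : Fin n) (X : Subset n) → flipAt i X ≢ X
flipAt-≢ i X e = not-¬ refl (trans (sym (cong (λ Y → lookup Y i) e)) (lookup∘update i X _))

⊆-insert : ∀ {n} (X : Subset n) i → X ⊆ X [ i ]≔ inside
⊆-insert X i {j} j∈X with j ≟ᶠ i
... | yes refl = []≔-updates X i
... | no j≢i   = []≔-minimal X j i j≢i j∈X

remove-⊆ : ∀ {n} (X : Subset n) i → X [ i ]≔ outside ⊆ X
remove-⊆ X i {j} j∈X′ with j ≟ᶠ i
... | yes refl = ⊥-elim (not-¬ ([]=⇒lookup j∈X′) (lookup∘update i X outside))
... | no j≢i   = lookup⇒[]= j X (trans (sym (lookup∘update′ j≢i X outside)) ([]=⇒lookup j∈X′))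

move-remove : ∀ {n} (X : Subset n) {i j} → i ≢ j → lookup X i ≡ true →
              move j i (X [ i ]≔ outside) ≡ X [ j ]≔ outside
move-remove X {i} {j} i≢j i∈X = begin
  ((X [ i ]≔ outside) [ j ]≔ outside) [ i ]≔ inside
    ≡⟨ cong (_[ i ]≔ inside) ([]≔-commutes X i j i≢j) ⟩
  (X′ [ i ]≔ outside) [ i ]≔ inside
    ≡⟨ []≔-idempotent X′ i ⟩
  X′ [ i ]≔ inside
    ≡⟨ cong (X′ [ i ]≔_) (trans (lookup∘update′ i≢j X outside) i∈X) ⟨
  X′ [ i ]≔ lookup X′ i
    ≡⟨ []≔-lookup X′ i ⟩
  X′ ∎
  where
  open ≡-Reasoning
  X′ = X [ j ]≔ outside

_[_↦_] : ∀ {n} {B : Set} → (Subset n → B) → Subset n → B → Subset n → B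
(f [ a ↦ v ]) X = if ⌊ X ≟S a ⌋ then v else f X

update-at : ∀ {n} {B : Set} (f : Subset n → B) a v → (f [ a ↦ v ]) a ≡ v
update-at f a v with a ≟S a
... | yes _  = refl
... | no a≢a = contradiction refl a≢a

update-off : ∀ {n} {B : Set} (f : Subset n → B) {a} v {X} → X ≢ a → (f [ a ↦ v ]) X ≡ f X
update-off f {a} v {X} X≢a with X ≟S a
... | yes X≡a = contradiction X≡a X≢a
... | no _    = refl

∑ˢ : ∀ {n} → (Subset n → ℕ) → ℕ
∑ˢ {n} f = sum (map f (allSubsets n))

∑ˢ-cong : ∀ {n} {f g : Subset n → ℕ} → f ≗ g → ∑ˢ f ≡ ∑ˢ g
∑ˢ-cong {n} f≗g = cong sum (map-cong f≗g (allSubsets n))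

∑ˢ-split : ∀ {n} x (f : Subset (suc n) → ℕ) →
           ∑ˢ f ≡ ∑ˢ (f ∘ (x ∷_)) + ∑ˢ (f ∘ (not x ∷_))
∑ˢ-split {n} true f = begin
  sum (map f (map (inside ∷_) L ++ map (outside ∷_) L))
    ≡⟨ cong sum (map-++ f (map (inside ∷_) L) _) ⟩
  sum (map f (map (inside ∷_) L) ++ map f (map (outside ∷_) L))
    ≡⟨ sum-++ (map f (map (inside ∷_) L)) _ ⟩
  sum (map f (map (inside ∷_) L)) + sum (map f (map (outside ∷_) L))
    ≡⟨ cong₂ (λ xs ys → sum xs + sum ys) (map-∘ L) (map-∘ L) ⟨
  ∑ˢ (f ∘ (inside ∷_)) + ∑ˢ (f ∘ (outside ∷_)) ∎
  where
  open ≡-Reasoning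
  L = allSubsets n
∑ˢ-split false f = trans (∑ˢ-split true f) (ℕ.+-comm (∑ˢ (f ∘ (inside ∷_))) _)

∑ˢ-update : ∀ {n} (a : Subset n) {g h : Subset n → ℕ} →
            (∀ X → X ≢ a → g X ≡ h X) → ∑ˢ g + h a ≡ ∑ˢ h + g a
∑ˢ-update [] {g} {h} _ = begin
  g [] + 0 + h []  ≡⟨ cong (_+ h []) (ℕ.+-identityʳ (g [])) ⟩
  g [] + h []      ≡⟨ ℕ.+-comm (g []) (h []) ⟩
  h [] + g []      ≡⟨ cong (_+ g []) (ℕ.+-identityʳ (h [])) ⟨
  h [] + 0 + g []  ∎
  where open ≡-Reasoning
∑ˢ-update (x ∷ a) {g} {h} g≡h = begin
  ∑ˢ g + h (x ∷ a)                ≡⟨ cong (_+ h (x ∷ a)) (∑ˢ-split x g) ⟩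
  G₁ + G₂ + h (x ∷ a)             ≡⟨ xy∙z≈xz∙y G₁ G₂ (h (x ∷ a)) ⟩
  G₁ + h (x ∷ a) + G₂             ≡⟨ cong₂ _+_ same-half other-half ⟩
  H₁ + g (x ∷ a) + H₂             ≡⟨ xy∙z≈xz∙y H₁ (g (x ∷ a)) H₂ ⟩
  H₁ + H₂ + g (x ∷ a)             ≡⟨ cong (_+ g (x ∷ a)) (∑ˢ-split x h) ⟨
  ∑ˢ h + g (x ∷ a)                ∎
  where
  open ≡-Reasoning
  G₁ = ∑ˢ (g ∘ (x ∷_))
  G₂ = ∑ˢ (g ∘ (not x ∷_))
  H₁ = ∑ˢ (h ∘ (x ∷_))
  H₂ = ∑ˢ (h ∘ (not x ∷_))
  same-half : G₁ + h (x ∷ a) ≡ H₁ + g (x ∷ a)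
  same-half = ∑ˢ-update a (λ X X≢a → g≡h (x ∷ X) (X≢a ∘ ∷-injectiveʳ))
  other-half : G₂ ≡ H₂
  other-half = ∑ˢ-cong {f = g ∘ (not x ∷_)} λ X →
    g≡h (not x ∷ X) λ e → not-¬ refl (sym (∷-injectiveˡ e))

∑ˢ-update₂ : ∀ {n} {a b : Subset n} {g h : Subset n → ℕ} → a ≢ b →
             (∀ X → X ≢ a → X ≢ b → g X ≡ h X) → ∑ˢ g + (h a + h b) ≡ ∑ˢ h + (g a + g b)
∑ˢ-update₂ {a = a} {b} {g} {h} a≢b g≡h = begin
  ∑ˢ g + (h a + h b)  ≡⟨ x∙yz≈xz∙y (∑ˢ g) (h a) (h b) ⟩
  ∑ˢ g + h b + h a    ≡⟨ cong (λ x → ∑ˢ g + x + h a) (update-off h (g a) (a≢b ∘ sym)) ⟨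
  ∑ˢ g + k b + h a    ≡⟨ cong (_+ h a) (∑ˢ-update b g≡k) ⟩
  ∑ˢ k + g b + h a    ≡⟨ xy∙z≈xz∙y (∑ˢ k) (g b) (h a) ⟩
  ∑ˢ k + h a + g b    ≡⟨ cong (_+ g b) (∑ˢ-update a (λ X X≢a → update-off h (g a) X≢a)) ⟩
  ∑ˢ h + k a + g b    ≡⟨ cong (λ x → ∑ˢ h + x + g b) (update-at h a (g a)) ⟩
  ∑ˢ h + g a + g b    ≡⟨ ℕ.+-assoc (∑ˢ h) (g a) (g b) ⟩
  ∑ˢ h + (g a + g b)  ∎
  where
  open ≡-Reasoning
  k = h [ a ↦ g a ]
  g≡k : ∀ X → X ≢ b → g X ≡ k X
  g≡k X X≢b with X ≟S a
  ... | yes refl = refl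
  ... | no X≢a   = g≡h X X≢a X≢b

length-filter : ∀ {a p} {A : Set a} {P : Pred A p} (P? : Decidable P) (xs : List A) →
                length (filter P? xs) ≡ sum (map (𝟙 ∘ does ∘ P?) xs)
length-filter P? []       = refl
length-filter P? (x ∷ xs) with does (P? x)
... | true  = cong suc (length-filter P? xs)
... | false = length-filter P? xs

does-≟-not : ∀ x y → does (x Bool.≟ not y) ≡ x xor y
does-≟-not true  true  = refl
does-≟-not true  false = refl
does-≟-not false true  = refl
does-≟-not false false = refl

influenceCount : ∀ {n} → Fin n → Family n → ℕ
influenceCount {n} i F = length (filter (λ A → F A Bool.≟ not (F (flipAt i A))) (allSubsets n))

pivotal : ∀ {n} → Fin n → Family n → Subset n → ℕ
pivotal i F X = 𝟙 (F X xor F (flipAt i X))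

influenceCount≡∑ˢ : ∀ {n} (i : Fin n) (F : Family n) → influenceCount i F ≡ ∑ˢ (pivotal i F)
influenceCount≡∑ˢ {n} i F =
  trans (length-filter (λ A → F A Bool.≟ not (F (flipAt i A))) (allSubsets n))
        (∑ˢ-cong λ X → cong 𝟙 (does-≟-not (F X) (F (flipAt i X))))

influenceCount-cong : ∀ {n} (i : Fin n) {F G : Family n} → F ≗ G →
                      influenceCount i F ≡ influenceCount i G
influenceCount-cong i {F} {G} F≗G = begin
  influenceCount i F  ≡⟨ influenceCount≡∑ˢ i F ⟩
  ∑ˢ (pivotal i F)    ≡⟨ ∑ˢ-cong (λ X → cong₂ (λ x y → 𝟙 (x xor y)) (F≗G X) (F≗G _)) ⟩
  ∑ˢ (pivotal i G)    ≡⟨ influenceCount≡∑ˢ i G ⟨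
  influenceCount i G  ∎
  where open ≡-Reasoning

pivotal-pair : ∀ {n} (i : Fin n) (F : Family n) X →
               pivotal i F X + pivotal i F (flipAt i X) ≡ 2 * pivotal i F X
pivotal-pair i F X = cong (pivotal i F X +_) (begin
  𝟙 (F (flipAt i X) xor F (flipAt i (flipAt i X)))
    ≡⟨ cong (λ Y → 𝟙 (F (flipAt i X) xor F Y)) (flipAt-involutive i X) ⟩
  𝟙 (F (flipAt i X) xor F X)
    ≡⟨ cong 𝟙 (xor-comm (F (flipAt i X)) (F X)) ⟩
  pivotal i F X
    ≡⟨ ℕ.+-identityʳ (pivotal i F X) ⟨
  pivotal i F X + 0 ∎)
  where open ≡-Reasoning

influenceCount-update : ∀ {n} (i : Fin n) (F : Family n) a v →
  influenceCount i (F [ a ↦ v ]) + 2 * 𝟙 (F a xor F (flipAt i a))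
    ≡ influenceCount i F + 2 * 𝟙 (v xor F (flipAt i a))
influenceCount-update i F a v = begin
  influenceCount i F′ + 2 * pivotal i F a
    ≡⟨ cong₂ _+_ (influenceCount≡∑ˢ i F′) (sym (pivotal-pair i F a)) ⟩
  ∑ˢ (pivotal i F′) + (pivotal i F a + pivotal i F (flipAt i a))
    ≡⟨ ∑ˢ-update₂ (flipAt-≢ i a ∘ sym) agree ⟩
  ∑ˢ (pivotal i F) + (pivotal i F′ a + pivotal i F′ (flipAt i a))
    ≡⟨ cong₂ _+_ (sym (influenceCount≡∑ˢ i F)) (pivotal-pair i F′ a) ⟩
  influenceCount i F + 2 * pivotal i F′ a
    ≡⟨ cong (λ x → influenceCount i F + 2 * 𝟙 (x xor F′ (flipAt i a))) (update-at F a v) ⟩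
  influenceCount i F + 2 * 𝟙 (v xor F′ (flipAt i a))
    ≡⟨ cong (λ x → influenceCount i F + 2 * 𝟙 (v xor x)) (update-off F v (flipAt-≢ i a)) ⟩
  influenceCount i F + 2 * 𝟙 (v xor F (flipAt i a)) ∎
  where
  open ≡-Reasoning
  F′ = F [ a ↦ v ]
  agree : ∀ X → X ≢ a → X ≢ flipAt i a → pivotal i F′ X ≡ pivotal i F X
  agree X X≢a X≢fa = cong₂ (λ x y → 𝟙 (x xor y)) (update-off F v X≢a) (update-off F v fX≢a)
    where
    fX≢a : flipAt i X ≢ a
    fX≢a fX≡a = X≢fa (trans (sym (flipAt-involutive i X)) (cong (flipAt i) fX≡a))

replace≗update : ∀ {n} (F : Family n) A P → replace F A P ≗ (F [ A ↦ false ]) [ P ↦ true ]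
replace≗update F A P D with D ≟S P | D ≟S A
... | yes _ | _     = ∨-zeroʳ _
... | no _  | yes _ = trans (∨-identityʳ _) (∧-zeroʳ (F D))
... | no _  | no _  = trans (∨-identityʳ _) (∧-identityʳ (F D))

-- Adding any i ∉ X enters F and removing any i ∈ X leaves F.
Critical : ∀ {n} → Family n → Subset n → Set
Critical F X = ∀ i → F (flipAt i X) ≡ not (lookup X i)

-- The two updates F ↦ F [ A ↦ false ] ↦ F [ A ↦ false ] [ P ↦ true ] for critical A ∈ F and
-- P ∉ F, in the shape influenceCount-update gives them (a and p are i ∈ A and i ∈ P).
exchange : ∀ {c c₁ c₀} a p →
           c + 2 * 𝟙 (false xor not p) ≡ c₁ + 2 * 𝟙 (true xor not p) →
           c₁ + 2 * 𝟙 (true xor not a) ≡ c₀ + 2 * 𝟙 (false xor not a) →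
           c + 4 * 𝟙 a ≡ c₀ + 4 * 𝟙 p
exchange {c} {c₁} {c₀} true true h₁ h₂ =
  cong (_+ 4) (trans (sym (ℕ.+-identityʳ c)) (trans h₁ (trans h₂ (ℕ.+-identityʳ c₀))))
exchange {c} {c₁} {c₀} true false h₁ h₂ = begin
  c + 4      ≡⟨ ℕ.+-assoc c 2 2 ⟨
  c + 2 + 2  ≡⟨ cong (_+ 2) (trans h₁ (ℕ.+-identityʳ c₁)) ⟩
  c₁ + 2     ≡⟨ h₂ ⟩
  c₀ + 0     ∎
  where open ≡-Reasoning
exchange {c} {c₁} {c₀} false true h₁ h₂ = begin
  c + 0       ≡⟨ h₁ ⟩
  c₁ + 2      ≡⟨ cong (_+ 2) (trans (sym (ℕ.+-identityʳ c₁)) h₂) ⟩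
  c₀ + 2 + 2  ≡⟨ ℕ.+-assoc c₀ 2 2 ⟩
  c₀ + 4      ∎
  where open ≡-Reasoning
exchange {c} {c₁} {c₀} false false h₁ h₂ = cong (_+ 0) (ℕ.+-cancelʳ-≡ 2 c c₀ (trans h₁ h₂))

influenceCount-replace : ∀ {n} (F : Family n) {A P : Subset n} →
  F A ≡ true → F P ≡ false → Critical F A → Critical F P → ∀ i → A ≢ flipAt i P →
  influenceCount i (replace F A P) + 4 * 𝟙 (lookup A i) ≡ influenceCount i F + 4 * 𝟙 (lookup P i)
influenceCount-replace F {A} {P} A∈F P∉F A-critical P-critical i A≢fP =
  trans (cong (_+ 4 * 𝟙 (lookup A i)) (influenceCount-cong i (replace≗update F A P)))
        (exchange {influenceCount i F₂} {influenceCount i F₁} {influenceCount i F}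
                  (lookup A i) (lookup P i) adding-P removing-A)
  where
  F₁ F₂ : Family _
  F₁ = F [ A ↦ false ]
  F₂ = F₁ [ P ↦ true ]
  P≢A : P ≢ A
  P≢A refl = not-¬ A∈F P∉F
  removing-A : influenceCount i F₁ + 2 * 𝟙 (true xor not (lookup A i))
             ≡ influenceCount i F + 2 * 𝟙 (false xor not (lookup A i))
  removing-A = subst₂ (λ x y → influenceCount i F₁ + 2 * 𝟙 x ≡ influenceCount i F + 2 * 𝟙 y)
    (cong₂ _xor_ A∈F (A-critical i)) (cong (false xor_) (A-critical i))
    (influenceCount-update i F A false)
  F₁-at-fP : F₁ (flipAt i P) ≡ not (lookup P i)
  F₁-at-fP = trans (update-off F false (A≢fP ∘ sym)) (P-critical i)
  adding-P : influenceCount i F₂ + 2 * 𝟙 (false xor not (lookup P i))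
           ≡ influenceCount i F₁ + 2 * 𝟙 (true xor not (lookup P i))
  adding-P = subst₂ (λ x y → influenceCount i F₂ + 2 * 𝟙 x ≡ influenceCount i F₁ + 2 * 𝟙 y)
    (cong₂ _xor_ (trans (update-off F false P≢A) P∉F) F₁-at-fP) (cong (true xor_) F₁-at-fP)
    (influenceCount-update i F₁ P true)

∑-update : ∀ {n} (i : Fin (suc n)) {f g : Fin (suc n) → ℕ} →
           (∀ j → j ≢ i → f j ≡ g j) → ∑[ j < suc n ] f j + g i ≡ ∑[ j < suc n ] g j + f i
∑-update i {f} {g} f≡g = begin
  ∑[ j < _ ] f j + g i                   ≡⟨ cong (_+ g i) (sum-remove f) ⟩
  f i + ∑[ j < _ ] f (punchIn i j) + g i ≡⟨ cong (λ x → f i + x + g i) rest ⟩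
  f i + ∑[ j < _ ] g (punchIn i j) + g i ≡⟨ xy∙z≈zy∙x (f i) _ (g i) ⟩
  g i + ∑[ j < _ ] g (punchIn i j) + f i ≡⟨ cong (_+ f i) (sum-remove g) ⟨
  ∑[ j < _ ] g j + f i                   ∎
  where
  open ≡-Reasoning
  rest : ∑[ j < _ ] f (punchIn i j) ≡ ∑[ j < _ ] g (punchIn i j)
  rest = sum-cong-≗ λ j → f≡g (punchIn i j) (punchInᵢ≢i i j)

size : ∀ {n} → Subset n → ℕ
size {n} X = ∑[ i < n ] 𝟙 (lookup X i)

size-remove : ∀ {n} (X : Subset (suc n)) {i} → lookup X i ≡ true →
              size X ≡ suc (size (X [ i ]≔ outside))
size-remove X {i} i∈X = begin
  size X                    ≡⟨ ℕ.+-identityʳ (size X) ⟨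
  size X + 0                ≡⟨ cong (λ b → size X + 𝟙 b) (lookup∘update i X outside) ⟨
  size X + 𝟙 (lookup X′ i)  ≡⟨ ∑-update i X≡X′-off-i ⟩
  size X′ + 𝟙 (lookup X i)  ≡⟨ cong (λ b → size X′ + 𝟙 b) i∈X ⟩
  size X′ + 1               ≡⟨ ℕ.+-comm (size X′) 1 ⟩
  suc (size X′)             ∎
  where
  open ≡-Reasoning
  X′ = X [ i ]≔ outside
  X≡X′-off-i : ∀ j → j ≢ i → 𝟙 (lookup X j) ≡ 𝟙 (lookup X′ j)
  X≡X′-off-i j j≢i = cong 𝟙 (sym (lookup∘update′ j≢i X outside))

totalCount : ∀ {n} → Family n → ℕ
totalCount {n} F = ∑[ i < n ] influenceCount i F

totalCount-replace : ∀ {n} (F : Family n) {A P : Subset n} →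
  F A ≡ true → F P ≡ false → Critical F A → Critical F P → (∀ i → A ≢ flipAt i P) →
  totalCount (replace F A P) + 4 * size A ≡ totalCount F + 4 * size P
totalCount-replace {n} F {A} {P} A∈F P∉F A-critical P-critical A≢fP = begin
  ∑[ i < n ] c′ i + 4 * ∑[ i < n ] 𝟙 (lookup A i)
    ≡⟨ cong (∑[ i < n ] c′ i +_) (*-distribˡ-sum {n} 4 (𝟙 ∘ lookup A)) ⟩
  ∑[ i < n ] c′ i + ∑[ i < n ] (4 * 𝟙 (lookup A i))
    ≡⟨ ∑-distrib-+ c′ _ ⟨
  ∑[ i < n ] (c′ i + 4 * 𝟙 (lookup A i))
    ≡⟨ sum-cong-≗ per-coordinate ⟩
  ∑[ i < n ] (c i + 4 * 𝟙 (lookup P i))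
    ≡⟨ ∑-distrib-+ c _ ⟩
  ∑[ i < n ] c i + ∑[ i < n ] (4 * 𝟙 (lookup P i))
    ≡⟨ cong (∑[ i < n ] c i +_) (*-distribˡ-sum {n} 4 (𝟙 ∘ lookup P)) ⟨
  ∑[ i < n ] c i + 4 * ∑[ i < n ] 𝟙 (lookup P i) ∎
  where
  open ≡-Reasoning
  c′ c : Fin n → ℕ
  c′ i = influenceCount i (replace F A P)
  c  i = influenceCount i F
  per-coordinate : ∀ i → c′ i + 4 * 𝟙 (lookup A i) ≡ c i + 4 * 𝟙 (lookup P i)
  per-coordinate i = influenceCount-replace F A∈F P∉F A-critical P-critical i (A≢fP i)

toℚᵘ-/ : ∀ c d .{{_ : NonZero d}} → toℚᵘ (ℤ.+ c / d) ≃ mkℚᵘ (ℤ.+ c) (pred d)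
toℚᵘ-/ c zero    = ⊥-elim (≢-nonZero⁻¹ 0 refl)
toℚᵘ-/ c (suc k) = ℚ.toℚᵘ-fromℚᵘ (mkℚᵘ (ℤ.+ c) k)

mkℚᵘ-+ : ∀ a b k → mkℚᵘ (ℤ.+ a) k +ᵘ mkℚᵘ (ℤ.+ b) k ≃ mkℚᵘ (ℤ.+ (a + b)) k
mkℚᵘ-+ a b k = *≡* (cross (ℤ.+ a) (ℤ.+ b) (ℤ.+ suc k))
  where
  open import Data.Integer.Tactic.RingSolver
  cross : ∀ x y d → (x ℤ.* d ℤ.+ y ℤ.* d) ℤ.* d ≡ (x ℤ.+ y) ℤ.* (d ℤ.* d)
  cross = solve-∀

mkℚᵘ-mono-< : ∀ {a b} k → a ℕ.< b → mkℚᵘ (ℤ.+ a) k <ᵘ mkℚᵘ (ℤ.+ b) k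
mkℚᵘ-mono-< k a<b = *<* (ℤ.*-monoʳ-<-pos (ℤ.+ suc k) (ℤ.+<+ a<b))

toℚᵘ-TotalInf : ∀ {n} (F : Family n) →
                toℚᵘ (TotalInf F) ≃ mkℚᵘ (ℤ.+ totalCount F) (pred (2 ^ n))
toℚᵘ-TotalInf {n} F = partial n (λ i → i)
  where
  open ℚᵘ.≃-Reasoning
  k = pred (2 ^ n)
  partial : ∀ m (g : Fin m → Fin n) →
            toℚᵘ (foldr (λ i q → Inf i F +ℚ q) 0ℚ (tabulate g))
              ≃ mkℚᵘ (ℤ.+ ∑[ j < m ] influenceCount (g j) F) k
  partial zero    g = *≡* refl
  partial (suc m) g = begin
    toℚᵘ (Inf g₀ F +ℚ rest)
      ≈⟨ ℚ.toℚᵘ-homo-+ (Inf g₀ F) rest ⟩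
    toℚᵘ (Inf g₀ F) +ᵘ toℚᵘ rest
      ≈⟨ ℚᵘ.+-cong (toℚᵘ-/ (influenceCount g₀ F) (2 ^ n) {{ℕ.m^n≢0 2 n}})
                   (partial m (g ∘ Fin.suc)) ⟩
    mkℚᵘ (ℤ.+ influenceCount g₀ F) k +ᵘ mkℚᵘ (ℤ.+ ∑[ j < m ] influenceCount (g (Fin.suc j)) F) k
      ≈⟨ mkℚᵘ-+ (influenceCount g₀ F) (∑[ j < m ] influenceCount (g (Fin.suc j)) F) k ⟩
    mkℚᵘ (ℤ.+ ∑[ j < suc m ] influenceCount (g j) F) k ∎
    where
    g₀ = g Fin.zero
    rest = foldr (λ i q → Inf i F +ℚ q) 0ℚ (tabulate (g ∘ Fin.suc))

TotalInf-< : ∀ {n} {F G : Family n} → totalCount G ℕ.< totalCount F → TotalInf G < TotalInf F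
TotalInf-< {n} {F} {G} lt = ℚ.toℚᵘ-cancel-<
  (ℚᵘ.<-respˡ-≃ (ℚᵘ.≃-sym (toℚᵘ-TotalInf G))
    (ℚᵘ.<-respʳ-≃ (ℚᵘ.≃-sym (toℚᵘ-TotalInf F)) (mkℚᵘ-mono-< (pred (2 ^ n)) lt)))

-- As j ∈ C, C is not the image of a moved set; stability then forbids moving C itself.
shift-stable⇒move-closed : ∀ {n} {F : Family n} {i j} → i ≢ j → (∀ C → shift j i F C ≡ F C) →
                           ∀ {C} → F C ≡ true → lookup C j ≡ true → lookup C i ≡ false →
                           F (move j i C) ≡ true
shift-stable⇒move-closed {n} {F} {i} {j} i≢j stable {C} C∈F j∈C i∉C = begin
  F (move j i C)              ≡⟨ not-involutive _ ⟨
  not (not (F (move j i C)))  ≡⟨ unfold-shift ⟨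
  shift j i F C               ≡⟨ stable C ⟩
  F C                         ≡⟨ C∈F ⟩
  true                        ∎
  where
  open ≡-Reasoning
  no-preimage : ∀ Ds →
    foldr (λ D b → (F D ∧ isMoved j i F D ∧ ⌊ move j i D ≟S C ⌋) ∨ b) false Ds ≡ false
  no-preimage []       = refl
  no-preimage (D ∷ Ds) with move j i D ≟S C
  ... | yes refl = ⊥-elim (not-¬ j∈C (trans (lookup∘update′ (i≢j ∘ sym) (D [ j ]≔ outside) inside)
                                              (lookup∘update j D outside)))
  ... | no _ rewrite ∧-zeroʳ (isMoved j i F D) | ∧-zeroʳ (F D) = no-preimage Ds
  unfold-shift : shift j i F C ≡ not (not (F (move j i C)))
  unfold-shift rewrite C∈F | j∈C | i∉C | no-preimage (allSubsets n) = ∨-identityʳ _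

module _ {m} {F : Family (suc m)} (increasing : Increasing F) where

  private
    ℓ = lastE m

  ∈I⇒last∈ : ∀ {A} → A ∈I F → lookup A ℓ ≡ true
  ∈I⇒last∈ {A} (A∈F , fA∉F) = ¬-not λ ℓ∉A →
    not-¬ (trans (cong F (flipAt-≡ ℓ∉A)) (increasing A _ (⊆-insert A ℓ) A∈F)) fA∉F

  dropLast≡flipAt : ∀ {B} → B ∈I F → dropLast B ≡ flipAt ℓ B
  dropLast≡flipAt B∈I = sym (flipAt-≡ (∈I⇒last∈ B∈I))

  flipAt-dropLast : ∀ {B} → B ∈I F → flipAt ℓ (dropLast B) ≡ B
  flipAt-dropLast {B} B∈I = trans (cong (flipAt ℓ) (dropLast≡flipAt B∈I)) (flipAt-involutive ℓ B)

  ∈I⇒dropLast∉ : ∀ {B} → B ∈I F → F (dropLast B) ≡ false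
  ∈I⇒dropLast∉ B∈I@(_ , fB∉F) = trans (cong F (dropLast≡flipAt B∈I)) fB∉F

  module _ (stable : Stable m F) where

    private
      move-closed : ∀ {i} → i ≢ ℓ → ∀ {C} → F C ≡ true →
                    lookup C ℓ ≡ true → lookup C i ≡ false → F (move ℓ i C) ≡ true
      move-closed i≢ℓ = shift-stable⇒move-closed i≢ℓ (proj₁ stable _ i≢ℓ)

    ∈I⇒Critical : ∀ {A} → A ∈I F → Critical F A
    ∈I⇒Critical {A} A∈I@(A∈F , fA∉F) i with i ≟ᶠ ℓ
    ... | yes refl = trans fA∉F (cong not (sym (∈I⇒last∈ A∈I)))
    ... | no i≢ℓ   = critical-at (lookup A i) refl
      where
      critical-at : ∀ b → lookup A i ≡ b → F (flipAt i A) ≡ not b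
      critical-at false i∉A = trans (cong F (flipAt-≡ i∉A)) (increasing A _ (⊆-insert A i) A∈F)
      critical-at true  i∈A = ¬-not λ fA∈F → not-¬ (ℓ-removed fA∈F) (∈I⇒dropLast∉ A∈I)
        where
        ℓ-removed : F (flipAt i A) ≡ true → F (dropLast A) ≡ true
        ℓ-removed fA∈F = trans (cong F (sym (move-remove A i≢ℓ i∈A)))
          (move-closed i≢ℓ (trans (cong F (sym (flipAt-≡ i∈A))) fA∈F)
            (trans (lookup∘update′ (i≢ℓ ∘ sym) A outside) (∈I⇒last∈ A∈I))
            (lookup∘update i A outside))

    ∈I⇒dropLast-Critical : ∀ {B} → B ∈I F → Critical F (dropLast B)
    ∈I⇒dropLast-Critical {B} B∈I@(B∈F , _) i with i ≟ᶠ ℓ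
    ... | yes refl =
      trans (cong F (flipAt-dropLast B∈I)) (trans B∈F (cong not (sym (lookup∘update ℓ B outside))))
    ... | no i≢ℓ   = critical-at (lookup P i) refl
      where
      P = dropLast B
      critical-at : ∀ b → lookup P i ≡ b → F (flipAt i P) ≡ not b
      critical-at false i∉P = trans (cong F (flipAt-≡ i∉P))
        (move-closed i≢ℓ B∈F (∈I⇒last∈ B∈I)
          (trans (sym (lookup∘update′ i≢ℓ B outside)) i∉P))
      critical-at true  i∈P = ¬-not λ fP∈F →
        not-¬ (increasing _ P (remove-⊆ P i) (trans (cong F (sym (flipAt-≡ i∈P))) fP∈F))
              (∈I⇒dropLast∉ B∈I)

    replace-decreases : ∀ {A B} → A ∈I F → B ∈I F → A ≢ B → size B ≤ size A →
                        TotalInf (replace F A (dropLast B)) < TotalInf F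
    replace-decreases {A} {B} A∈I B∈I A≢B B≤A = TotalInf-< {F = F} {replace F A P}
      (ℕ.+-cancelʳ-< (4 * size A) (totalCount (replace F A P)) (totalCount F) (begin-strict
        totalCount (replace F A P) + 4 * size A  ≡⟨ count-identity ⟩
        totalCount F + 4 * size P                <⟨ ℕ.+-monoʳ-< (totalCount F) (ℕ.*-monoʳ-< 4 P<A) ⟩
        totalCount F + 4 * size A                ∎))
      where
      open ℕ.≤-Reasoning
      P = dropLast B
      P<A : size P ℕ.< size A
      P<A = subst (_≤ size A) (size-remove B (∈I⇒last∈ B∈I)) B≤A
      A≢fP : ∀ i → A ≢ flipAt i P
      A≢fP i A≡fP with i ≟ᶠ ℓ
      ... | yes refl = A≢B (trans A≡fP (flipAt-dropLast B∈I))
      ... | no i≢ℓ   = not-¬ (∈I⇒last∈ A∈I) ℓ∉A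
        where
        ℓ∉A : lookup A ℓ ≡ false
        ℓ∉A = trans (cong (λ X → lookup X ℓ) A≡fP)
                (trans (lookup∘update′ (i≢ℓ ∘ sym) P _) (lookup∘update ℓ B outside))
      count-identity : totalCount (replace F A P) + 4 * size A ≡ totalCount F + 4 * size P
      count-identity = totalCount-replace F (proj₁ A∈I) (∈I⇒dropLast∉ B∈I)
                         (∈I⇒Critical A∈I) (∈I⇒dropLast-Critical B∈I) A≢fP

lemma7p9 : (m : ℕ) (F : Family (suc m)) → Increasing F → Stable m F →
           (A B : Subset (suc m)) → A ∈I F → B ∈I F → ¬ (A ≡ B) →
           (TotalInf (replace F A (dropLast B)) < TotalInf F)
           ⊎ (TotalInf (replace F B (dropLast A)) < TotalInf F)
lemma7p9 m F increasing stable A B A∈I B∈I A≢B =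
  Sum.map (replace-decreases increasing stable {A} {B} A∈I B∈I A≢B)
          (replace-decreases increasing stable {B} {A} B∈I A∈I (A≢B ∘ sym))
          (ℕ.≤-total (size B) (size A))
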